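{- For every integer $n\geq 1$, $d_n \geq 2^{2^{n-1}}$.
   Context: A delta-matroid $(E,\mathcal F)$ consists of a finite set $E$ and a non-empty collection $\mathcal F$ of subsets of $E$ satisfying: for all $X,Y\in\mathcal F$ and every $e\in X\bigtriangleup Y$ there exists $f\in X\bigtriangleup Y$ (possibly $f=e$) with $X\bigtriangleup\{e,f\}\in\mathcal F$. Let $d_n$ denote the number of delta-matroids with ground set $[n]=\{1,\dots,n\}$. -}

module Defs where

open import Data.Nat using (ℕ)
open import Data.Bool using (Bool; true)
open import Data.Fin using (Fin)
open import Data.Fin.Subset using (Subset; _∈_; _∪_; _─_; ⁅_⁆)
open import Data.Product using (∃; _×_)
open import Relation.Binary.PropositionalEquality using (_≡_)

infixl 5 _△_
_△_ : {n : ℕ} → Subset n → Subset n → Subset n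
X △ Y = (X ─ Y) ∪ (Y ─ X)

Family : ℕ → Set
Family n = Subset n → Bool

_∈F_ : {n : ℕ} → Subset n → Family n → Set
X ∈F 𝓕 = 𝓕 X ≡ true

-- Delta-matroid axioms: 𝓕 non-empty and the symmetric exchange axiom.
-- {e,f} is ⁅ e ⁆ ∪ ⁅ f ⁆ (equal to {e} when f = e).
IsDeltaMatroid : {n : ℕ} → Family n → Set
IsDeltaMatroid {n} 𝓕 =
  (∃ λ (X : Subset n) → X ∈F 𝓕)
  × (∀ (X Y : Subset n) → X ∈F 𝓕 → Y ∈F 𝓕 →
       ∀ (e : Fin n) → e ∈ (X △ Y) →
       ∃ λ (f : Fin n) → f ∈ (X △ Y) × ((X △ (⁅ e ⁆ ∪ ⁅ f ⁆)) ∈F 𝓕))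

-- Every family of subsets of [n] that contains all odd sets is a delta-matroid: from an
-- even X flip e alone; from an odd X flip e together with another f ∈ X △ Y, and if
-- there is none then X △ Y = {e} and flipping e lands on Y. The even sets may then be
-- added arbitrarily, and there are 2^(n-1) of them, namely (parity S ∷ S) for S ⊆ [n-1].
module Submission where

open import Defs
open import Algebra.Bundles using (CommutativeRing)
open import Algebra.Properties.CommutativeSemigroup using (interchange)
open import Data.Bool using (Bool; true; false; _∨_; _xor_)
open import Data.Bool.Properties using (not-involutive; xor-same; xor-∧-commutativeRing)
open import Data.Empty using (⊥-elim)
open import Data.Fin using (Fin; zero; suc; combine; quotient; remainder; finToFun; funToFin)
open import Data.Fin.Properties using (_≟_; any?; combine-remQuot; funToFin-finToFin; 2↔Bool)
open import Data.Fin.Subset using (Subset; _∈_; _∪_; ⁅_⁆; ⊥)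
open import Data.Fin.Subset.Properties using (x∈⁅x⁆; x∈⁅y⁆⇒x≡y; ⊆-antisym; ∪-idem; ∪-identityˡ; ∪-identityʳ; _∈?_)
open import Data.Nat as ℕ using (ℕ; _≤_; _∸_; _^_; s≤s; z≤n)
open import Data.Product using (Σ; _×_; _,_)
open import Data.Vec using ([]; _∷_)
open import Function using (_∘_)
open import Function.Bundles using (Inverse; Injection)
open import Function.Properties.Inverse using (↔⇒↣)
open import Relation.Binary.PropositionalEquality
open import Relation.Nullary using (yes; no; ¬?)
open import Relation.Nullary.Decidable using (_×-dec_)

private
  variable
    m n : ℕ

xor-interchange : ∀ a b c d → (a xor b) xor (c xor d) ≡ (a xor c) xor (b xor d)
xor-interchange = interchange (CommutativeRing.+-commutativeSemigroup xor-∧-commutativeRing)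

△-∷ : ∀ b c (X Y : Subset n) → (b ∷ X) △ (c ∷ Y) ≡ (b xor c) ∷ (X △ Y)
△-∷ false false X Y = refl
△-∷ false true  X Y = refl
△-∷ true  false X Y = refl
△-∷ true  true  X Y = refl

△-cancelˡ : (X Y : Subset n) → X △ (X △ Y) ≡ Y
△-cancelˡ [] [] = refl
△-cancelˡ (b ∷ X) (c ∷ Y) = begin
  (b ∷ X) △ ((b ∷ X) △ (c ∷ Y))      ≡⟨ cong ((b ∷ X) △_) (△-∷ b c X Y) ⟩
  (b ∷ X) △ ((b xor c) ∷ (X △ Y))    ≡⟨ △-∷ b (b xor c) X (X △ Y) ⟩
  (b xor (b xor c)) ∷ (X △ (X △ Y))  ≡⟨ cong₂ _∷_ (xor-cancelˡ b) (△-cancelˡ X Y) ⟩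
  c ∷ Y                              ∎
  where
  open ≡-Reasoning
  xor-cancelˡ : ∀ b → b xor (b xor c) ≡ c
  xor-cancelˡ false = refl
  xor-cancelˡ true  = not-involutive c

⁅⁆-unique : {x : Fin n} {p : Subset n} → x ∈ p → (∀ y → y ∈ p → y ≡ x) → p ≡ ⁅ x ⁆
⁅⁆-unique {x = x} x∈p unique =
  ⊆-antisym (λ {y} y∈p → subst (_∈ ⁅ x ⁆) (sym (unique y y∈p)) (x∈⁅x⁆ x))
            (λ {y} y∈⁅x⁆ → subst (_∈ _) (sym (x∈⁅y⁆⇒x≡y x y∈⁅x⁆)) x∈p)

parity : Subset n → Bool
parity []      = false
parity (b ∷ X) = b xor parity X

parity-△ : (X Y : Subset n) → parity (X △ Y) ≡ parity X xor parity Y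
parity-△ [] [] = refl
parity-△ (b ∷ X) (c ∷ Y) = begin
  parity ((b ∷ X) △ (c ∷ Y))           ≡⟨ cong parity (△-∷ b c X Y) ⟩
  (b xor c) xor parity (X △ Y)         ≡⟨ cong ((b xor c) xor_) (parity-△ X Y) ⟩
  (b xor c) xor (parity X xor parity Y) ≡⟨ xor-interchange b c (parity X) (parity Y) ⟩
  (b xor parity X) xor (c xor parity Y) ∎
  where open ≡-Reasoning

parity-⊥ : parity (⊥ {n}) ≡ false
parity-⊥ {ℕ.zero}  = refl
parity-⊥ {ℕ.suc n} = parity-⊥ {n}

parity-⁅⁆ : (e : Fin n) → parity ⁅ e ⁆ ≡ true
parity-⁅⁆ {ℕ.suc n} zero rewrite parity-⊥ {n} = refl
parity-⁅⁆ (suc e) = parity-⁅⁆ e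

parity-⁅⁆∪⁅⁆ : {e f : Fin n} → e ≢ f → parity (⁅ e ⁆ ∪ ⁅ f ⁆) ≡ false
parity-⁅⁆∪⁅⁆ {e = zero} {zero} e≢f = ⊥-elim (e≢f refl)
parity-⁅⁆∪⁅⁆ {e = zero} {suc f} e≢f
  rewrite ∪-identityˡ ⁅ f ⁆ | parity-⁅⁆ f = refl
parity-⁅⁆∪⁅⁆ {e = suc e} {zero} e≢f
  rewrite ∪-identityʳ ⁅ e ⁆ | parity-⁅⁆ e = refl
parity-⁅⁆∪⁅⁆ {e = suc e} {suc f} e≢f = parity-⁅⁆∪⁅⁆ (e≢f ∘ cong suc)

ContainsOddSets : Family n → Set
ContainsOddSets 𝓕 = ∀ X → parity X ≡ true → X ∈F 𝓕

containsOddSets⇒isDeltaMatroid : {𝓕 : Family (ℕ.suc n)} → ContainsOddSets 𝓕 → IsDeltaMatroid 𝓕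
containsOddSets⇒isDeltaMatroid {n = n} {𝓕 = 𝓕} odd⊆𝓕 =
  (⁅ zero ⁆ , odd⊆𝓕 ⁅ zero ⁆ (parity-⁅⁆ {ℕ.suc n} zero)) , exchange
  where
  exchange : ∀ X Y → X ∈F 𝓕 → Y ∈F 𝓕 → ∀ e → e ∈ (X △ Y) →
             Σ (Fin _) λ f → f ∈ (X △ Y) × ((X △ (⁅ e ⁆ ∪ ⁅ f ⁆)) ∈F 𝓕)
  exchange X Y _ Y∈𝓕 e e∈X△Y with parity X in parityX
  ... | false = e , e∈X△Y , odd⊆𝓕 _ (begin
    parity (X △ (⁅ e ⁆ ∪ ⁅ e ⁆))        ≡⟨ parity-△ X (⁅ e ⁆ ∪ ⁅ e ⁆) ⟩
    parity X xor parity (⁅ e ⁆ ∪ ⁅ e ⁆) ≡⟨ cong₂ _xor_ parityX (cong parity (∪-idem ⁅ e ⁆)) ⟩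
    parity ⁅ e ⁆                        ≡⟨ parity-⁅⁆ e ⟩
    true                                ∎)
    where open ≡-Reasoning
  ... | true with any? (λ f → (f ∈? (X △ Y)) ×-dec ¬? (e ≟ f))
  ...   | yes (f , f∈X△Y , e≢f) = f , f∈X△Y , odd⊆𝓕 _
            (trans (parity-△ X (⁅ e ⁆ ∪ ⁅ f ⁆)) (cong₂ _xor_ parityX (parity-⁅⁆∪⁅⁆ e≢f)))
  ...   | no no-other = e , e∈X△Y , subst (_∈F 𝓕) (sym flip-e≡Y) Y∈𝓕
    where
    only-e : ∀ f → f ∈ (X △ Y) → f ≡ e
    only-e f f∈X△Y with e ≟ f
    ... | yes e≡f = sym e≡f
    ... | no  e≢f = ⊥-elim (no-other (f , f∈X△Y , e≢f))

    flip-e≡Y : X △ (⁅ e ⁆ ∪ ⁅ e ⁆) ≡ Y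
    flip-e≡Y = begin
      X △ (⁅ e ⁆ ∪ ⁅ e ⁆) ≡⟨ cong (X △_) (∪-idem ⁅ e ⁆) ⟩
      X △ ⁅ e ⁆           ≡⟨ cong (X △_) (⁅⁆-unique e∈X△Y only-e) ⟨
      X △ (X △ Y)         ≡⟨ △-cancelˡ X Y ⟩
      Y                   ∎
      where open ≡-Reasoning

withOddSets : (Subset m → Bool) → Family (ℕ.suc m)
withOddSets H (b ∷ S) = (b xor parity S) ∨ H S

withOddSets-containsOddSets : (H : Subset m → Bool) → ContainsOddSets (withOddSets H)
withOddSets-containsOddSets H (b ∷ S) odd rewrite odd = refl

withOddSets-injective : {G H : Subset m → Bool} →
  (∀ X → withOddSets G X ≡ withOddSets H X) → ∀ S → G S ≡ H S
withOddSets-injective eq S with eq (parity S ∷ S)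
... | even rewrite xor-same (parity S) = even

funToFin-cong : {f g : Fin m → Fin n} → (∀ k → f k ≡ g k) → funToFin f ≡ funToFin g
funToFin-cong {ℕ.zero}  f≗g = refl
funToFin-cong {ℕ.suc m} f≗g = cong₂ combine (f≗g zero) (funToFin-cong (f≗g ∘ suc))

finToFun-injective : {i j : Fin (m ^ n)} → (∀ k → finToFun {m} {n} i k ≡ finToFun j k) → i ≡ j
finToFun-injective {m = m} {n = n} {i} {j} eq = begin
  i                              ≡⟨ funToFin-finToFin {n} {m} i ⟨
  funToFin (finToFun {m} {n} i)  ≡⟨ funToFin-cong eq ⟩
  funToFin (finToFun {m} {n} j)  ≡⟨ funToFin-finToFin {n} {m} j ⟩
  j                              ∎
  where open ≡-Reasoning

open Inverse 2↔Bool using (to; from; strictlyInverseʳ)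
open Injection (↔⇒↣ 2↔Bool) using (injective)

toIndex : Subset m → Fin (2 ^ m)
toIndex []      = zero
toIndex (b ∷ S) = combine (from b) (toIndex S)

fromIndex : Fin (2 ^ m) → Subset m
fromIndex {ℕ.zero}  _ = []
fromIndex {ℕ.suc m} k = to (quotient (2 ^ m) k) ∷ fromIndex (remainder {2} (2 ^ m) k)

toIndex-fromIndex : (k : Fin (2 ^ m)) → toIndex (fromIndex {m} k) ≡ k
toIndex-fromIndex {ℕ.zero}  zero = refl
toIndex-fromIndex {ℕ.suc m} k = begin
  combine (from (to q)) (toIndex (fromIndex {m} r))
    ≡⟨ cong₂ combine (strictlyInverseʳ q) (toIndex-fromIndex {m} r) ⟩
  combine q r
    ≡⟨ combine-remQuot {2} (2 ^ m) k ⟩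
  k ∎
  where
  open ≡-Reasoning
  q : Fin 2
  q = quotient (2 ^ m) k
  r : Fin (2 ^ m)
  r = remainder {2} (2 ^ m) k

truthTable : Fin (2 ^ (2 ^ m)) → Subset m → Bool
truthTable i = to ∘ finToFun i ∘ toIndex

truthTable-injective : {i j : Fin (2 ^ (2 ^ m))} →
  (∀ S → truthTable i S ≡ truthTable j S) → i ≡ j
truthTable-injective {m = m} {i} {j} eq = finToFun-injective λ k → begin
  bits i k                   ≡⟨ cong (bits i) (toIndex-fromIndex {m} k) ⟨
  bits i (toIndex (S k))     ≡⟨ injective (eq (S k)) ⟩
  bits j (toIndex (S k))     ≡⟨ cong (bits j) (toIndex-fromIndex {m} k) ⟩
  bits j k                   ∎
  where
  open ≡-Reasoning
  bits : Fin (2 ^ (2 ^ m)) → Fin (2 ^ m) → Fin 2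
  bits = finToFun
  S : Fin (2 ^ m) → Subset m
  S = fromIndex

corollary6 : (n : ℕ) → 1 ≤ n →
    Σ (Fin (2 ^ (2 ^ (n ∸ 1))) → Family n) λ ι →
      ((i : Fin (2 ^ (2 ^ (n ∸ 1)))) → IsDeltaMatroid (ι i))
      × ((i j : Fin (2 ^ (2 ^ (n ∸ 1)))) → ((X : Subset n) → ι i X ≡ ι j X) → i ≡ j)
corollary6 (ℕ.suc m) (s≤s z≤n) =
    withOddSets ∘ truthTable
  , (λ i → containsOddSets⇒isDeltaMatroid (withOddSets-containsOddSets (truthTable i)))
  , (λ i j same → truthTable-injective (withOddSets-injective same))
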